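{- Let $(S,d_S)$ be a finite metric space. For any optimal solution $(\lambda,(c_v)_{v\in S})$ of the linear program $\mathcal{L}$, the value of $\lambda$ equals the minimum dilation of any admissible star spanning $S$, and the star whose center is joined to each $v\in S$ by an edge of length $c_v$ is an admissible star spanning $S$ with this minimum dilation.
   Context: The linear program $\mathcal{L}$ has real variables $\lambda$ and $c_v$ ($v\in S$), constraints $c_v\ge 0$ for all $v\in S$, and for all distinct $v,w\in S$: $c_v+c_w\ge d_S(v,w)$ and $c_v+c_w\le\lambda\cdot d_S(v,w)$, and objective: minimize $\lambda$. A star spanning $S$ is a weighted graph with a center vertex $c$ and an edge of weight $w_{v,c}$ from $c$ to each $v\in S$ and no other edges; $d_H$ is its shortest-path distance, so $d_H(u,v)=w_{u,c}+w_{c,v}$ for distinct $u,v\in S$. It is admissible if its distances are symmetric, obey the triangle inequality, and satisfy $d_H(x,y)\ge d_S(x,y)$ for all $x,y\in S$. Its dilation is $\max_{u\neq v\in S} d_H(u,v)/d_S(u,v)$. -}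

module Defs where

open import Level using (Level; _⊔_; suc)
open import Data.Nat using (ℕ)
open import Data.Fin using (Fin)
open import Data.Fin.Properties using (_≟_)
open import Data.Product using (Σ; ∃; _×_; _,_)
open import Relation.Nullary using (¬_; yes; no)
open import Relation.Binary.PropositionalEquality using (_≡_; _≢_)
open import Relation.Binary.Structures using (IsTotalOrder)
open import Algebra.Structures using (IsCommutativeRing)

record OrderedField (c ℓ : Level) : Set (Level.suc (c ⊔ ℓ)) where
  infixl 6 _+_
  infixl 7 _*_
  infix 4 _≤_
  field
    Carrier : Set c
    _+_ _*_ : Carrier → Carrier → Carrier
    -_      : Carrier → Carrier
    0# 1#   : Carrier
    _≤_     : Carrier → Carrier → Set ℓ
    isCommutativeRing : IsCommutativeRing _≡_ _+_ _*_ -_ 0# 1#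
    isTotalOrder      : IsTotalOrder _≡_ _≤_
    0≢1     : 0# ≢ 1#
    inverse : ∀ x → x ≢ 0# → Σ Carrier λ y → x * y ≡ 1#
    +-mono  : ∀ {x y} z → x ≤ y → x + z ≤ y + z
    *-nonneg : ∀ {x y} → 0# ≤ x → 0# ≤ y → 0# ≤ x * y

  _<_ : Carrier → Carrier → Set (c ⊔ ℓ)
  x < y = (x ≤ y) × (x ≢ y)

module _ {c ℓ : Level} (F : OrderedField c ℓ) where
  open OrderedField F

  record IsMetric (n : ℕ) (d : Fin n → Fin n → Carrier) : Set (c ⊔ ℓ) where
    field
      nonneg    : ∀ x y → 0# ≤ d x y
      zero-iff  : ∀ x y → (d x y ≡ 0# → x ≡ y) × (x ≡ y → d x y ≡ 0#)
      symmetric : ∀ x y → d x y ≡ d y x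
      triangle  : ∀ x y z → d x z ≤ d x y + d y z

  module _ {n : ℕ} (dS : Fin n → Fin n → Carrier) where

    Feasible : Carrier → (Fin n → Carrier) → Set ℓ
    Feasible λ' cv =
      (∀ v → 0# ≤ cv v) ×
      (∀ v w → v ≢ w → (dS v w ≤ cv v + cv w) × (cv v + cv w ≤ λ' * dS v w))

    Optimal : Carrier → (Fin n → Carrier) → Set (c ⊔ ℓ)
    Optimal λ' cv = Feasible λ' cv × (∀ μ cw → Feasible μ cw → λ' ≤ μ)

    -- A star spanning S: center joined to each v ∈ S by an edge of
    -- (nonnegative) weight w v; dH is its shortest-path distance on S.
    StarWeights : Set (c ⊔ ℓ)
    StarWeights = Σ (Fin n → Carrier) λ w → ∀ v → 0# ≤ w v

    dH : (Fin n → Carrier) → Fin n → Fin n → Carrier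
    dH w u v with u ≟ v
    ... | yes _ = 0#
    ... | no  _ = w u + w v

    Admissible : (Fin n → Carrier) → Set (c ⊔ ℓ)
    Admissible w =
      (∀ x y → dH w x y ≡ dH w y x) ×
      (∀ x y z → dH w x z ≤ dH w x y + dH w y z) ×
      (∀ x y → dS x y ≤ dH w x y)

    -- δ is the dilation max_{u≠v} dH(u,v)/dS(u,v) of the star w
    -- (dS(u,v) > 0 for u ≠ v, so ratio ≤ δ iff dH ≤ δ·dS).
    IsDilation : (Fin n → Carrier) → Carrier → Set (c ⊔ ℓ)
    IsDilation w δ =
      (∀ u v → u ≢ v → dH w u v ≤ δ * dS u v) ×
      (∃ λ u → ∃ λ v → u ≢ v × dH w u v ≡ δ * dS u v)

    IsMinDilation : Carrier → Set (c ⊔ ℓ)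
    IsMinDilation μ =
      (Σ StarWeights λ (w , _) → Admissible w × IsDilation w μ) ×
      (∀ (W : StarWeights) δ → let (w , _) = W in
         Admissible w → IsDilation w δ → μ ≤ δ)

module Submission where

-- Let (λ, c) be optimal for L.  Two facts give the theorem.
--  * Weak duality: the edge weights w of an admissible star of dilation δ
--    satisfy all constraints of L with objective δ (between distinct leaves
--    dH(u,v) = w u + w v), so λ ≤ δ.
--  * The star with weights c is admissible (star distances with
--    nonnegative weights form a metric dominating dS because of the lower
--    constraints) and has dilation exactly λ: the upper constraints bound it
--    by λ, and some upper constraint is tight, since otherwise the largest
--    ratio (c u + c v) / dS(u,v) over distinct pairs would be a feasible
--    objective smaller than λ.  Distinct pairs exist because on a one-point
--    space L is unbounded below.

open import Defs
open import Level using (Level)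
open import Data.Nat using (ℕ; zero; suc)
open import Data.Fin using (Fin; zero; suc)
open import Data.Fin.Properties using (_≟_)
open import Data.List using (List; allFin; cartesianProduct; filter)
open import Data.List.Membership.Propositional.Properties
  using (∈-filter⁺; ∈-cartesianProduct⁺; ∈-allFin)
open import Data.List.Relation.Unary.All using (lookup)
open import Data.List.Relation.Unary.All.Properties using (all-filter)
open import Data.Product using (_×_; ∃₂; _,_; proj₁; proj₂)
open import Data.Sum using (_⊎_; inj₁; inj₂)
open import Function using (_∘_)
open import Relation.Nullary using (¬_; ¬?; Dec; yes; no; contradiction)
open import Relation.Binary.PropositionalEquality
  using (_≡_; _≢_; refl; sym; trans; cong; cong₂; subst; subst₂; module ≡-Reasoning)
open import Relation.Binary.Bundles using (TotalOrder)
open import Algebra.Bundles using (CommutativeRing; Ring)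
open import Algebra.Structures using (module IsCommutativeRing)
import Algebra.Properties.Group as GroupProperties
import Algebra.Properties.RingWithoutOne as RingProperties
import Data.List.Extrema as Extrema
import Relation.Binary.Reasoning.PartialOrder as ≤-Reasoning

Fin-trivial-or-distinct-pair : ∀ n → (∀ (x y : Fin n) → x ≡ y) ⊎ ∃₂ λ (u v : Fin n) → u ≢ v
Fin-trivial-or-distinct-pair zero          = inj₁ λ ()
Fin-trivial-or-distinct-pair (suc zero)    = inj₁ λ { zero zero → refl }
Fin-trivial-or-distinct-pair (suc (suc k)) = inj₂ (zero , suc zero , λ ())

module DistinctPairs {b ℓ₁ ℓ₂} (T : TotalOrder b ℓ₁ ℓ₂) where
  open TotalOrder T using (Carrier; _≤_)
  open Extrema T using (argmax; f[xs]≤f[argmax]; argmax-all)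

  Distinct : ∀ {n} → Fin n × Fin n → Set
  Distinct (u , v) = u ≢ v

  distinct? : ∀ {n} (p : Fin n × Fin n) → Dec (Distinct p)
  distinct? (u , v) = ¬? (u ≟ v)

  allPairs : ∀ n → List (Fin n × Fin n)
  allPairs n = cartesianProduct (allFin n) (allFin n)

  distinctPairs : ∀ n → List (Fin n × Fin n)
  distinctPairs n = filter distinct? (allPairs n)

  max-over-distinct-pairs : ∀ {n} (g : Fin n → Fin n → Carrier) {u₀ v₀ : Fin n} → u₀ ≢ v₀ →
    ∃₂ λ i j → i ≢ j × (∀ x y → x ≢ y → g x y ≤ g i j)
  max-over-distinct-pairs {n} g {u₀} {v₀} u₀≢v₀ = i , j , i≢j , maximal
    where
    g′ : Fin n × Fin n → Carrier
    g′ (x , y) = g x y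

    best : Fin n × Fin n
    best = argmax g′ (u₀ , v₀) (distinctPairs n)

    i j : Fin n
    i = proj₁ best
    j = proj₂ best

    i≢j : i ≢ j
    i≢j = argmax-all g′ {P = Distinct} u₀≢v₀ (all-filter distinct? (allPairs n))

    maximal : ∀ x y → x ≢ y → g x y ≤ g i j
    maximal x y x≢y = lookup (f[xs]≤f[argmax] (u₀ , v₀) (distinctPairs n))
      (∈-filter⁺ distinct? (∈-cartesianProduct⁺ (∈-allFin x) (∈-allFin y)) x≢y)

module OrderedFieldLemmas {a ℓ} (F : OrderedField a ℓ) where
  open OrderedField F
  open IsCommutativeRing isCommutativeRing
    using (+-comm; +-identityˡ; +-identityʳ; -‿inverseʳ; *-assoc; *-comm; *-identityʳ)

  commutativeRing : CommutativeRing a a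
  commutativeRing = record { isCommutativeRing = isCommutativeRing }

  totalOrder : TotalOrder a a ℓ
  totalOrder = record { isTotalOrder = isTotalOrder }

  open TotalOrder totalOrder public using (antisym; total)
    renaming (refl to ≤-refl; trans to ≤-trans; reflexive to ≤-reflexive)
  open GroupProperties (CommutativeRing.+-group commutativeRing)
    using (//-rightDividesʳ; ⁻¹-involutive)
  open RingProperties (Ring.ringWithoutOne (CommutativeRing.ring commutativeRing))
    using (-‿distribˡ-*; -‿distribʳ-*; [y-z]x≈yx-zx)

  +-mono₂-≤ : ∀ {x y u v} → x ≤ y → u ≤ v → x + u ≤ y + v
  +-mono₂-≤ {x} {y} {u} {v} x≤y u≤v =
    ≤-trans (+-mono u x≤y) (subst₂ _≤_ (+-comm u y) (+-comm v y) (+-mono y u≤v))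

  +-cancelʳ-≤ : ∀ {x y} z → x + z ≤ y + z → x ≤ y
  +-cancelʳ-≤ {x} {y} z p = subst₂ _≤_ (//-rightDividesʳ z x) (//-rightDividesʳ z y) (+-mono (- z) p)

  ≤⇒0≤- : ∀ {x y} → x ≤ y → 0# ≤ y + - x
  ≤⇒0≤- {x} {y} p = subst (_≤ y + - x) (-‿inverseʳ x) (+-mono (- x) p)

  0≤-⇒≤ : ∀ {x y} → 0# ≤ y + - x → x ≤ y
  0≤-⇒≤ {x} {y} p = +-cancelʳ-≤ (- x) (subst (_≤ y + - x) (sym (-‿inverseʳ x)) p)

  ≤-+ʳ : ∀ x {y} → 0# ≤ y → x ≤ x + y
  ≤-+ʳ x {y} 0≤y = subst (_≤ x + y) (+-identityʳ x) (+-mono₂-≤ ≤-refl 0≤y)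

  ≤-+ˡ : ∀ x {y} → 0# ≤ y → x ≤ y + x
  ≤-+ˡ x {y} 0≤y = subst (_≤ y + x) (+-identityˡ x) (+-mono₂-≤ 0≤y ≤-refl)

  +-nonneg : ∀ {x y} → 0# ≤ x → 0# ≤ y → 0# ≤ x + y
  +-nonneg {x} {y} 0≤x 0≤y = ≤-trans 0≤x (≤-+ʳ x 0≤y)

  *-monoʳ-≤ : ∀ {x y} d → 0# ≤ d → x ≤ y → x * d ≤ y * d
  *-monoʳ-≤ {x} {y} d 0≤d x≤y =
    0≤-⇒≤ (subst (0# ≤_) ([y-z]x≈yx-zx d y x) (*-nonneg (≤⇒0≤- x≤y) 0≤d))

  _⁻¹⟨_⟩ : ∀ d → d ≢ 0# → Carrier
  d ⁻¹⟨ d≢0 ⟩ = proj₁ (inverse d d≢0)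

  *-⁻¹-cancelʳ : ∀ z d (d≢0 : d ≢ 0#) → z * d * d ⁻¹⟨ d≢0 ⟩ ≡ z
  *-⁻¹-cancelʳ z d d≢0 = begin
      z * d * d ⁻¹⟨ d≢0 ⟩   ≡⟨ *-assoc z d _ ⟩
      z * (d * d ⁻¹⟨ d≢0 ⟩) ≡⟨ cong (z *_) (proj₂ (inverse d d≢0)) ⟩
      z * 1#                ≡⟨ *-identityʳ z ⟩
      z                     ∎
    where open ≡-Reasoning

  ⁻¹-*-cancelʳ : ∀ z d (d≢0 : d ≢ 0#) → z * d ⁻¹⟨ d≢0 ⟩ * d ≡ z
  ⁻¹-*-cancelʳ z d d≢0 = begin
      z * d ⁻¹⟨ d≢0 ⟩ * d   ≡⟨ *-assoc z _ d ⟩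
      z * (d ⁻¹⟨ d≢0 ⟩ * d) ≡⟨ cong (z *_) (*-comm _ d) ⟩
      z * (d * d ⁻¹⟨ d≢0 ⟩) ≡⟨ *-assoc z d _ ⟨
      z * d * d ⁻¹⟨ d≢0 ⟩   ≡⟨ *-⁻¹-cancelʳ z d d≢0 ⟩
      z                     ∎
    where open ≡-Reasoning

  *-cancelʳ-≡ : ∀ {x y} d → d ≢ 0# → x * d ≡ y * d → x ≡ y
  *-cancelʳ-≡ {x} {y} d d≢0 xd≡yd = begin
      x                     ≡⟨ *-⁻¹-cancelʳ x d d≢0 ⟨
      x * d * d ⁻¹⟨ d≢0 ⟩   ≡⟨ cong (_* d ⁻¹⟨ d≢0 ⟩) xd≡yd ⟩
      y * d * d ⁻¹⟨ d≢0 ⟩   ≡⟨ *-⁻¹-cancelʳ y d d≢0 ⟩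
      y                     ∎
    where open ≡-Reasoning

  *-cancelʳ-≤ : ∀ {x y} d → 0# ≤ d → d ≢ 0# → x * d ≤ y * d → x ≤ y
  *-cancelʳ-≤ {x} {y} d 0≤d d≢0 xd≤yd with total x y
  ... | inj₁ x≤y = x≤y
  ... | inj₂ y≤x = ≤-reflexive (*-cancelʳ-≡ d d≢0 (antisym xd≤yd (*-monoʳ-≤ d 0≤d y≤x)))

  square-nonneg : ∀ x → 0# ≤ x * x
  square-nonneg x with total 0# x
  ... | inj₁ 0≤x = *-nonneg 0≤x 0≤x
  ... | inj₂ x≤0 = subst (0# ≤_) -x*-x≡x*x (*-nonneg 0≤-x 0≤-x)
    where
    open ≡-Reasoning
    0≤-x : 0# ≤ - x
    0≤-x = subst₂ _≤_ (-‿inverseʳ x) (+-identityˡ (- x)) (+-mono (- x) x≤0)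
    -x*-x≡x*x : - x * - x ≡ x * x
    -x*-x≡x*x = begin
      - x * - x       ≡⟨ -‿distribˡ-* x (- x) ⟨
      - (x * - x)     ≡⟨ cong -_ (-‿distribʳ-* x x) ⟨
      - (- (x * x))   ≡⟨ ⁻¹-involutive (x * x) ⟩
      x * x           ∎

  0≤1 : 0# ≤ 1#
  0≤1 = subst (0# ≤_) (*-identityʳ 1#) (square-nonneg 1#)

  x≰x-1 : ∀ x → ¬ (x ≤ x + - 1#)
  x≰x-1 x x≤x-1 = 0≢1 (antisym 0≤1 1≤0)
    where
    0≤-1 : 0# ≤ - 1#
    0≤-1 = +-cancelʳ-≤ x (subst₂ _≤_ (sym (+-identityˡ x)) (+-comm x (- 1#)) x≤x-1)
    1≤0 : 1# ≤ 0#
    1≤0 = 0≤-⇒≤ (subst (0# ≤_) (sym (+-identityˡ (- 1#))) 0≤-1)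

-- Distances in a star spanning Fin n with edge weights w.
module StarDistances {a ℓ} (F : OrderedField a ℓ) {n : ℕ} (dS : Fin n → Fin n → OrderedField.Carrier F) where
  open OrderedField F
  open OrderedFieldLemmas F
  open IsCommutativeRing isCommutativeRing using (+-comm; +-identityˡ; +-identityʳ)
  open ≤-Reasoning (TotalOrder.poset totalOrder)

  NonNeg : (Fin n → Carrier) → Set ℓ
  NonNeg w = ∀ v → 0# ≤ w v

  dH-distinct : ∀ w {x y} → x ≢ y → dH F dS w x y ≡ w x + w y
  dH-distinct w {x} {y} x≢y with x ≟ y
  ... | yes x≡y = contradiction x≡y x≢y
  ... | no _    = refl

  dH-self : ∀ w x → dH F dS w x x ≡ 0#
  dH-self w x with x ≟ x
  ... | yes _   = refl
  ... | no x≢x  = contradiction refl x≢x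

  dH-sym : ∀ w x y → dH F dS w x y ≡ dH F dS w y x
  dH-sym w x y with x ≟ y | y ≟ x
  ... | yes _   | yes _   = refl
  ... | yes x≡y | no y≢x  = contradiction (sym x≡y) y≢x
  ... | no x≢y  | yes y≡x = contradiction (sym y≡x) x≢y
  ... | no _    | no _    = +-comm (w x) (w y)

  dH-≤-sum : ∀ {w} → NonNeg w → ∀ x y → dH F dS w x y ≤ w x + w y
  dH-≤-sum {w} w≥0 x y with x ≟ y
  ... | yes _ = +-nonneg (w≥0 x) (w≥0 y)
  ... | no _  = ≤-refl

  -- Star distances with nonnegative weights satisfy the triangle inequality:
  -- a detour through a third leaf y traverses both edges of x and z.
  dH-triangle : ∀ {w} → NonNeg w → ∀ x y z → dH F dS w x z ≤ dH F dS w x y + dH F dS w y z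
  dH-triangle {w} w≥0 x y z with y ≟ x
  ... | yes refl = ≤-reflexive (sym (trans (cong (_+ dH F dS w y z) (dH-self w y)) (+-identityˡ _)))
  ... | no y≢x with z ≟ y
  ...   | yes refl = ≤-reflexive (sym (trans (cong (dH F dS w x z +_) (dH-self w z)) (+-identityʳ _)))
  ...   | no z≢y = begin
      dH F dS w x z                  ≤⟨ dH-≤-sum w≥0 x z ⟩
      w x + w z                      ≤⟨ +-mono₂-≤ (≤-+ʳ (w x) (w≥0 y)) (≤-+ˡ (w z) (w≥0 y)) ⟩
      (w x + w y) + (w y + w z)      ≡⟨ cong₂ _+_ (dH-distinct w (y≢x ∘ sym)) (dH-distinct w (z≢y ∘ sym)) ⟨
      dH F dS w x y + dH F dS w y z  ∎

module LinearProgram {a ℓ} (F : OrderedField a ℓ) {n : ℕ}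
    (dS : Fin n → Fin n → OrderedField.Carrier F) (metric : IsMetric F n dS) where
  open OrderedField F
  open OrderedFieldLemmas F
  open StarDistances F dS
  open IsMetric metric using (nonneg; zero-iff)
  open DistinctPairs totalOrder using (max-over-distinct-pairs)

  dS-nonzero : ∀ {u v} → u ≢ v → dS u v ≢ 0#
  dS-nonzero {u} {v} u≢v d≡0 = u≢v (proj₁ (zero-iff u v) d≡0)

  star-admissible : ∀ {w} → NonNeg w → (∀ u v → u ≢ v → dS u v ≤ w u + w v) → Admissible F dS w
  star-admissible {w} w≥0 covers = dH-sym w , dH-triangle w≥0 , dominates
    where
    dominates : ∀ x y → dS x y ≤ dH F dS w x y
    dominates x y with x ≟ y
    ... | yes refl = ≤-reflexive (proj₂ (zero-iff x x) refl)
    ... | no x≢y   = covers x y x≢y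

  -- The star of a feasible solution is admissible: its lower constraints say
  -- that the star distances dominate dS.
  feasible⇒admissible : ∀ {λ' c} → Feasible F dS λ' c → Admissible F dS c
  feasible⇒admissible (c≥0 , constraints) =
    star-admissible c≥0 (λ u v u≢v → proj₁ (constraints u v u≢v))

  star⇒feasible : ∀ {w δ} → NonNeg w → Admissible F dS w → IsDilation F dS w δ → Feasible F dS δ w
  star⇒feasible {w} {δ} w≥0 (_ , _ , dS≤dH) (dH≤δdS , _) = w≥0 , λ u v u≢v →
    subst (dS u v ≤_) (dH-distinct w u≢v) (dS≤dH u v) ,
    subst (_≤ δ * dS u v) (dH-distinct w u≢v) (dH≤δdS u v u≢v)

  optimal≤dilation : ∀ {λ' c} → Optimal F dS λ' c →
    ∀ (W : StarWeights F dS) δ → Admissible F dS (proj₁ W) → IsDilation F dS (proj₁ W) δ → λ' ≤ δ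
  optimal≤dilation (_ , minimal) (w , w≥0) δ admissible dilation =
    minimal δ w (star⇒feasible w≥0 admissible dilation)

  -- If S has no two distinct points every λ is feasible, so no optimum
  -- exists; an optimal solution therefore provides a distinct pair.
  optimal⇒distinct-pair : ∀ {λ' c} → Optimal F dS λ' c → ∃₂ λ (u v : Fin n) → u ≢ v
  optimal⇒distinct-pair {λ'} {c} ((c≥0 , _) , minimal) with Fin-trivial-or-distinct-pair n
  ... | inj₂ pair    = pair
  ... | inj₁ trivial = contradiction (minimal (λ' + - 1#) c (c≥0 , vacuous)) (x≰x-1 λ')
    where
    vacuous : ∀ u v → u ≢ v → dS u v ≤ c u + c v × c u + c v ≤ (λ' + - 1#) * dS u v
    vacuous u v u≢v = contradiction (trivial u v) u≢v

  -- The ratio (c u + c v) / dS(u,v) of an upper constraint of L; its value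
  -- on the diagonal is irrelevant.
  ratio : (Fin n → Carrier) → Fin n → Fin n → Carrier
  ratio c u v with u ≟ v
  ... | yes _  = 0#
  ... | no u≢v = (c u + c v) * dS u v ⁻¹⟨ dS-nonzero u≢v ⟩

  ratio-spec : ∀ c {u v} → u ≢ v → ratio c u v * dS u v ≡ c u + c v
  ratio-spec c {u} {v} u≢v with u ≟ v
  ... | yes u≡v = contradiction u≡v u≢v
  ... | no u≢v′ = ⁻¹-*-cancelʳ (c u + c v) (dS u v) (dS-nonzero u≢v′)

  -- At an optimum some upper constraint is tight: otherwise the largest
  -- ratio μ of the upper constraints would be a feasible objective below λ.
  optimal⇒tight : ∀ {λ' c} → Optimal F dS λ' c → ∃₂ λ u v → u ≢ v × c u + c v ≡ λ' * dS u v
  optimal⇒tight {λ'} {c} optimal@((c≥0 , constraints) , minimal)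
    with optimal⇒distinct-pair optimal
  ... | _ , _ , u₀≢v₀ with max-over-distinct-pairs (ratio c) u₀≢v₀
  ...   | i , j , i≢j , maximal = i , j , i≢j , tight
    where
    μ : Carrier
    μ = ratio c i j

    μ-feasible : Feasible F dS μ c
    μ-feasible = c≥0 , λ u v u≢v → proj₁ (constraints u v u≢v) ,
      subst (_≤ μ * dS u v) (ratio-spec c u≢v)
        (*-monoʳ-≤ (dS u v) (nonneg u v) (maximal u v u≢v))

    μ≤λ : μ ≤ λ'
    μ≤λ = *-cancelʳ-≤ (dS i j) (nonneg i j) (dS-nonzero i≢j)
      (subst (_≤ λ' * dS i j) (sym (ratio-spec c i≢j)) (proj₂ (constraints i j i≢j)))

    tight : c i + c j ≡ λ' * dS i j
    tight = trans (sym (ratio-spec c i≢j)) (cong (_* dS i j) (antisym μ≤λ (minimal μ c μ-feasible)))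

  optimal⇒dilation : ∀ {λ' c} → Optimal F dS λ' c → IsDilation F dS c λ'
  optimal⇒dilation {λ'} {c} optimal@((_ , constraints) , _) = bounded , attained
    where
    bounded : ∀ u v → u ≢ v → dH F dS c u v ≤ λ' * dS u v
    bounded u v u≢v = subst (_≤ λ' * dS u v) (sym (dH-distinct c u≢v)) (proj₂ (constraints u v u≢v))
    attained : ∃₂ λ u v → u ≢ v × dH F dS c u v ≡ λ' * dS u v
    attained with optimal⇒tight optimal
    ... | i , j , i≢j , tight = i , j , i≢j , trans (dH-distinct c i≢j) tight

lemma1 : ∀ {c ℓ : Level} (F : OrderedField c ℓ) (n : ℕ)
           (dS : Fin n → Fin n → OrderedField.Carrier F) → IsMetric F n dS →
           ∀ (λ' : OrderedField.Carrier F) (cv : Fin n → OrderedField.Carrier F) →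
           Optimal F dS λ' cv →
           IsMinDilation F dS λ' × Admissible F dS cv × IsDilation F dS cv λ'
lemma1 F n dS metric λ' cv optimal@(feasible@(cv≥0 , _) , _) =
  (((cv , cv≥0) , admissible , dilation) , optimal≤dilation optimal) , admissible , dilation
  where
  open LinearProgram F dS metric
  admissible : Admissible F dS cv
  admissible = feasible⇒admissible feasible
  dilation : IsDilation F dS cv λ'
  dilation = optimal⇒dilation optimal
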